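{- Let $\varphi$ be a sentence as in the context. Then $\varphi$ belongs to GBSR (axiomatic definition) if and only if for all $k,\ell$ with $1\le\ell\le k\le n$ it holds $\mathrm{vars}(\mathcal{L}_k)\cap\vec{x}_\ell=\emptyset$.
   Context: Let $\varphi := \forall \vec{x}_1 \exists \vec{y}_1 \ldots \forall \vec{x}_n \exists \vec{y}_n.\,\psi$ be a sentence in standard form ($\vec{x}_i,\vec{y}_i$ tuples of variables, $\vec{x}_1$, $\vec{y}_n$ possibly empty; $\psi$ quantifier-free, in negation normal form, using only $\wedge,\vee,\neg$; every prefix variable occurs in $\psi$; no variable bound twice) that may contain equality and constant symbols but no non-constant function symbols. Let $\vec{x}:=\bigcup_i\vec{x}_i$, $\vec{y}:=\bigcup_i\vec{y}_i$, $\mathrm{At}$ the set of atoms of $\varphi$, and $\mathrm{vars}(S)$ the set of variables in a set $S$ of atoms or literals. Axiomatic definition: $\varphi$ belongs to GBSR iff $\mathrm{At}$ can be partitioned into sets $\mathrm{At}_0,\ldots,\mathrm{At}_n$ with (i) $\mathrm{vars}(\mathrm{At}_i)\subseteq \vec{y}_1\cup\ldots\cup\vec{y}_i\cup\vec{x}_{i+1}\cup\ldots\cup\vec{x}_n$ for all $0\le i\le n$, and (ii) $\mathrm{vars}(\mathrm{At}_i)\cap\mathrm{vars}(\mathrm{At}_j)\cap\vec{x}=\emptyset$ for all $0\le i<j\le n$. Let $\mathcal{G}_\varphi$ be the undirected graph with vertex set $\vec{x}$ and an edge between $x,x'$ iff some atom of $\varphi$ contains both. For a connected component $C$ of $\mathcal{G}_\varphi$,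 $\mathcal{L}(C)$ is the set of literals of $\varphi$ containing at least one variable from $C$. For $1\le k\le n$, $\mathcal{L}_k$ is the smallest set of literals such that it contains all literals of $\varphi$ in which variables from $\vec{y}_k$ occur, and for every connected component $C$ of $\mathcal{G}_\varphi$ containing a variable $x\in\mathrm{vars}(\mathcal{L}_k)$ we have $\mathcal{L}(C)\subseteq\mathcal{L}_k$. -}

module Defs where

open import Data.Nat using (ℕ; _≤_; _<_)
open import Data.Fin using (Fin; toℕ) renaming (suc to fsuc)
open import Data.List using (List; []; _∷_; _++_; concatMap; allFin; map)
open import Data.List.Membership.Propositional using (_∈_)
open import Data.List.Relation.Unary.Unique.Propositional using (Unique)
open import Data.Product using (Σ; ∃; ∃-syntax; _×_)
open import Data.Empty using (⊥)
open import Data.Sum using (_⊎_)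
open import Relation.Binary.PropositionalEquality using (_≢_)
open import Relation.Binary.Construct.Closure.ReflexiveTransitive using (Star)

Var : Set
Var = ℕ

data Term : Set where
  var   : Var → Term
  const : ℕ → Term

data Atom : Set where
  pred : ℕ → List Term → Atom
  eq   : Term → Term → Atom

data Literal : Set where
  pos : Atom → Literal
  neg : Atom → Literal

data NNF : Set where
  lit  : Literal → NNF
  _∧_  : NNF → NNF → NNF
  _∨_  : NNF → NNF → NNF

varsT : Term → List Var
varsT (var v)   = v ∷ []
varsT (const c) = []

varsA : Atom → List Var
varsA (pred p ts) = concatMap varsT ts
varsA (eq s t)    = varsT s ++ varsT t

atomOf : Literal → Atom
atomOf (pos a) = a
atomOf (neg a) = a

varsL : Literal → List Var
varsL l = varsA (atomOf l)

lits : NNF → List Literal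
lits (lit l)  = l ∷ []
lits (φ ∧ ψ)  = lits φ ++ lits ψ
lits (φ ∨ ψ)  = lits φ ++ lits ψ

-- Sentences  ∀x⃗₁∃y⃗₁ … ∀x⃗ₙ∃y⃗ₙ. ψ
-- Blocks are indexed by Fin n; block i : Fin n is block number (toℕ i + 1)
-- of the paper.

record Sentence : Set where
  field
    n   : ℕ
    xb  : Fin n → List Var
    yb  : Fin n → List Var
    mat : NNF

module _ (φ : Sentence) where
  open Sentence φ

  prefixVars : List Var
  prefixVars = concatMap (λ i → xb i ++ yb i) (allFin n)

  Lits : List Literal
  Lits = lits mat

  At : List Atom
  At = map atomOf Lits

  InX : Var → Set
  InX v = ∃[ i ] v ∈ xb i

  record StandardForm : Set where
    field
      -- only x⃗₁ and y⃗ₙ may be empty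
      xNonEmpty    : ∀ (i : Fin n) → 1 ≤ toℕ i → xb i ≢ []
      yNonEmpty    : ∀ (i : Fin n) → ℕ.suc (toℕ i) < n → yb i ≢ []
      noRebinding  : Unique prefixVars
      allOccur     : ∀ v → v ∈ prefixVars → ∃[ l ] (l ∈ Lits × v ∈ varsL l)
      closed       : ∀ v l → l ∈ Lits → v ∈ varsL l → v ∈ prefixVars

  -- Axiomatic definition of GBSR.
  -- A partition At₀,…,Atₙ of At is given by a map f assigning to each
  -- atom its part index in Fin (suc n) (part i = At_{toℕ i}); parts may be empty.

  -- v ∈ y⃗₁ ∪ … ∪ y⃗ᵢ ∪ x⃗ᵢ₊₁ ∪ … ∪ x⃗ₙ   (i = toℕ p, 0 ≤ i ≤ n)
  AllowedIn : Fin (ℕ.suc n) → Var → Set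
  AllowedIn p v = ∃[ j ] ((toℕ j < toℕ p × v ∈ yb j) ⊎ (toℕ p ≤ toℕ j × v ∈ xb j))

  GBSR : Set
  GBSR = Σ (Atom → Fin (ℕ.suc n)) λ f →
           (∀ a v → a ∈ At → v ∈ varsA a → AllowedIn (f a) v)
           ×
           (∀ a b v → a ∈ At → b ∈ At → toℕ (f a) < toℕ (f b) →
              v ∈ varsA a → v ∈ varsA b → InX v → ⊥)

  Edge : Var → Var → Set
  Edge v w = InX v × InX w × ∃[ a ] (a ∈ At × v ∈ varsA a × w ∈ varsA a)

  -- w lies in the connected component of the vertex v (v ∈ x⃗ assumed separately)
  Reach : Var → Var → Set
  Reach = Star Edge

  data InL (k : Fin n) : Literal → Set where
    base    : ∀ {l v} → l ∈ Lits → v ∈ yb k → v ∈ varsL l → InL k l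
    closure : ∀ {l l' v w} → InL k l → v ∈ varsL l → InX v →
              Reach v w → l' ∈ Lits → w ∈ varsL l' → InL k l'

-- If φ ∈ GBSR via a partition At₀,…,Atₙ, atoms sharing an x-variable lie in the same part,
-- so every atom reachable in 𝒢_φ from an atom with a variable of y⃗ₖ lies in some Atᵢ with
-- i ≥ k; by (i) its x-variables then come from x⃗ᵢ₊₁,…,x⃗ₙ.  Conversely, label every atom by
-- the least index of an x-block met by its connected component (n if there is none); the
-- condition on the ℒₖ says that the y-variables of an atom come from strictly earlier blocks,
-- so the labels define a GBSR partition.  Reachability in 𝒢_φ is not decidable as given, so the
-- labels are computed instead: starting from the least x-block of each atom, repeatedly relabel
-- every atom with the minimum label of the atoms it shares an x-variable with; the sum of all
-- labels decreases until the labelling is stable.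

module Submission where

open import Defs
open import Data.Fin using (Fin; toℕ; fromℕ<)
open import Data.Fin.Properties using (toℕ-fromℕ<; toℕ<n) renaming (any? to anyFin?)
open import Data.Nat using (ℕ; suc; _≤_; _<_; _≟_; s≤s)
open import Data.Nat.Properties using (≤-refl; ≤-trans; <⇒≤; <-≤-trans; <-irrefl; <-cmp; ≤∧≢⇒<; ≰⇒>; +-mono-≤; +-mono-<-≤; +-mono-≤-<; <⇒≱)
open import Data.Nat.Induction using (<-wellFounded)
open import Data.Nat.ListAction using (sum)
open import Data.List using (List; []; _∷_; _++_; map; filter; concatMap; allFin)
open import Data.List.Extrema.Nat using (min; min≤⊤; min≤xs; argmin-sel)
open import Data.List.Membership.Propositional using (_∈_; lose; find)
open import Data.List.Membership.Propositional.Properties using (∈-map⁺; ∈-map⁻; ∈-filter⁺; ∈-filter⁻; ∈-++⁺ˡ; ∈-++⁺ʳ; ∈-++⁻; ∈-concatMap⁺; ∈-concatMap⁻; ∈-allFin)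
open import Data.List.Membership.DecPropositional _≟_ using (_∈?_)
open import Data.List.Relation.Unary.Any using (Any; here; there) renaming (any? to anyList?)
open import Data.List.Relation.Unary.All using (All) renaming (all? to allList?; lookup to All-lookup)
open import Data.List.Relation.Unary.All.Properties using (¬All⇒Any¬) renaming (++⁻ˡ to All-++⁻ˡ)
open import Data.List.Relation.Unary.Unique.Propositional using (Unique)
open import Data.List.Relation.Unary.AllPairs using ([]; _∷_)
open import Data.List.Relation.Binary.Disjoint.Propositional using (Disjoint)
open import Data.Product using (∃₂; ∃-syntax; _×_; _,_; proj₁; proj₂)
open import Data.Sum using (_⊎_; inj₁; inj₂)
open import Data.Empty using (⊥; ⊥-elim)
open import Function using (id)
open import Function.Bundles using (_⇔_; mk⇔)
open import Induction.WellFounded using (Acc; acc)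
open import Relation.Nullary using (yes; no; ¬_)
open import Relation.Nullary.Decidable using (_×-dec_)
open import Relation.Unary using (Decidable)
open import Relation.Binary using (tri<; tri≈; tri>)
open import Relation.Binary.PropositionalEquality using (_≡_; _≢_; refl; sym; trans; subst; subst₂)
open import Relation.Binary.Construct.Closure.ReflexiveTransitive using (ε; _◅_)

module _ {A : Set} where

  Unique-++⁻ : ∀ xs {ys : List A} → Unique (xs ++ ys) → Unique xs × Unique ys × Disjoint xs ys
  Unique-++⁻ []       u          = [] , u , λ { (() , _) }
  Unique-++⁻ (x ∷ xs) (x∉ ∷ u) with Unique-++⁻ xs u
  ... | uxs , uys , disjoint = All-++⁻ˡ xs x∉ ∷ uxs , uys , λ
    { (here refl , q) → All-lookup x∉ (∈-++⁺ʳ xs q) refl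
    ; (there p   , q) → disjoint (p , q) }

module _ {I A : Set} (h : I → List A) where

  Unique-concatMap⁻ : ∀ {is i} → Unique (concatMap h is) → i ∈ is → Unique (h i)
  Unique-concatMap⁻ {i ∷ is} u (here refl) = proj₁ (Unique-++⁻ (h i) u)
  Unique-concatMap⁻ {j ∷ is} u (there p)   = Unique-concatMap⁻ (proj₁ (proj₂ (Unique-++⁻ (h j) u))) p

  Unique-concatMap⇒∈-injective : ∀ {is i j v} → Unique (concatMap h is) →
                                 i ∈ is → j ∈ is → v ∈ h i → v ∈ h j → i ≡ j
  Unique-concatMap⇒∈-injective {k ∷ is} u p q vi vj with Unique-++⁻ (h k) u
  ... | _ , u′ , disjoint with p | q
  ...   | here refl | here refl = refl
  ...   | here refl | there q′  = ⊥-elim (disjoint (vi , ∈-concatMap⁺ h (lose q′ vj)))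
  ...   | there p′  | here refl = ⊥-elim (disjoint (vj , ∈-concatMap⁺ h (lose p′ vi)))
  ...   | there p′  | there q′  = Unique-concatMap⇒∈-injective u′ p′ q′ vi vj

module _ {A : Set} {P : A → Set} (P? : Decidable P) (h : A → ℕ) (d : ℕ) where

  minOver : List A → ℕ
  minOver xs = min d (map h (filter P? xs))

  minOver≤ : ∀ {xs x} → x ∈ xs → P x → minOver xs ≤ h x
  minOver≤ {xs} x∈xs px = All-lookup (min≤xs d _) (∈-map⁺ h (∈-filter⁺ P? x∈xs px))

  minOver≤default : ∀ xs → minOver xs ≤ d
  minOver≤default xs = min≤⊤ d (map h (filter P? xs))

  minOver-sel : ∀ xs → minOver xs ≡ d ⊎ ∃[ x ] (x ∈ xs × P x × minOver xs ≡ h x)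
  minOver-sel xs with argmin-sel id d (map h (filter P? xs))
  ... | inj₁ e = inj₁ e
  ... | inj₂ m with ∈-map⁻ h m
  ...   | x , x∈ , e with ∈-filter⁻ P? x∈
  ...     | x∈xs , px = inj₂ (x , x∈xs , px , e)

module _ {A : Set} {f g : A → ℕ} (f≤g : ∀ x → f x ≤ g x) where

  sum-map-mono-≤ : ∀ xs → sum (map f xs) ≤ sum (map g xs)
  sum-map-mono-≤ []       = ≤-refl
  sum-map-mono-≤ (x ∷ xs) = +-mono-≤ (f≤g x) (sum-map-mono-≤ xs)

  sum-map-mono-< : ∀ {xs} → Any (λ x → f x ≢ g x) xs → sum (map f xs) < sum (map g xs)
  sum-map-mono-< {x ∷ xs} (here fx≢gx) = +-mono-<-≤ (≤∧≢⇒< (f≤g x) fx≢gx) (sum-map-mono-≤ xs)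
  sum-map-mono-< {x ∷ xs} (there p)    = +-mono-≤-< (f≤g x) (sum-map-mono-< p)

module _ {X : Set} {P Stable : X → Set} (stable? : Decidable Stable)
         (step : X → X) (μ : X → ℕ)
         (step-decreases : ∀ {x} → ¬ Stable x → μ (step x) < μ x)
         (step-preserves : ∀ {x} → P x → P (step x)) where

  iterate-to-stable : ∀ {x} → P x → ∃[ y ] (P y × Stable y)
  iterate-to-stable {x} = go x (<-wellFounded (μ x))
    where
    go : ∀ x → Acc _<_ (μ x) → P x → ∃[ y ] (P y × Stable y)
    go x (acc rs) px with stable? x
    ... | yes s = x , px , s
    ... | no ¬s = go (step x) (rs (step-decreases ¬s)) (step-preserves px)

NoEarlierX : Sentence → Set
NoEarlierX φ = ∀ (k ℓ : Fin (Sentence.n φ)) → toℕ ℓ ≤ toℕ k →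
               ∀ v l → InL φ k l → v ∈ varsL l → v ∈ Sentence.xb φ ℓ → ⊥

module _ (φ : Sentence) (sf : StandardForm φ) where
  open Sentence φ
  open StandardForm sf

  private
    block : Fin n → List Var
    block i = xb i ++ yb i

    block-injective : ∀ {v i j} → v ∈ block i → v ∈ block j → i ≡ j
    block-injective {i = i} {j} =
      Unique-concatMap⇒∈-injective block noRebinding (∈-allFin i) (∈-allFin j)

  x-block-unique : ∀ {v i j} → v ∈ xb i → v ∈ xb j → i ≡ j
  x-block-unique p q = block-injective (∈-++⁺ˡ p) (∈-++⁺ˡ q)

  y-block-unique : ∀ {v i j} → v ∈ yb i → v ∈ yb j → i ≡ j
  y-block-unique {i = i} {j} p q = block-injective (∈-++⁺ʳ (xb i) p) (∈-++⁺ʳ (xb j) q)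

  x∉y-block : ∀ {v i j} → v ∈ xb i → v ∈ yb j → ⊥
  x∉y-block {i = i} {j} p q with block-injective (∈-++⁺ˡ p) (∈-++⁺ʳ (xb j) q)
  ... | refl = proj₂ (proj₂ (Unique-++⁻ (xb i) (Unique-concatMap⁻ block noRebinding (∈-allFin i)))) (p , q)

  prefix-block : ∀ {v} → v ∈ prefixVars φ → ∃[ i ] (v ∈ xb i ⊎ v ∈ yb i)
  prefix-block v∈ with find (∈-concatMap⁻ block {xs = allFin n} v∈)
  ... | i , _ , v∈i = i , ∈-++⁻ (xb i) v∈i

  x-block⊆prefix : ∀ {v i} → v ∈ xb i → v ∈ prefixVars φ
  x-block⊆prefix {i = i} p = ∈-concatMap⁺ block (lose (∈-allFin i) (∈-++⁺ˡ p))

  module _ (G : GBSR φ) where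
    private
      part = proj₁ G
      allowed = proj₁ (proj₂ G)
      separated = proj₂ (proj₂ G)

    x-sharing⇒same-part : ∀ {a b v} → a ∈ At φ → b ∈ At φ → v ∈ varsA a → v ∈ varsA b →
                          InX φ v → toℕ (part a) ≡ toℕ (part b)
    x-sharing⇒same-part {a} {b} a∈ b∈ va vb vx with <-cmp (toℕ (part a)) (toℕ (part b))
    ... | tri< lt _ _ = ⊥-elim (separated a b _ a∈ b∈ lt va vb vx)
    ... | tri≈ _ e _  = e
    ... | tri> _ _ gt = ⊥-elim (separated b a _ b∈ a∈ gt vb va vx)

    reach⇒same-part : ∀ {a b v w} → a ∈ At φ → v ∈ varsA a → InX φ v → Reach φ v w →
                      b ∈ At φ → w ∈ varsA b → toℕ (part a) ≡ toℕ (part b)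
    reach⇒same-part a∈ va vx ε b∈ wb = x-sharing⇒same-part a∈ b∈ va wb vx
    reach⇒same-part a∈ va vx ((_ , ux , c , c∈ , vc , uc) ◅ r) b∈ wb =
      trans (x-sharing⇒same-part a∈ c∈ va vc vx) (reach⇒same-part c∈ uc ux r b∈ wb)

    ℒ⇒later-part : ∀ {k l} → InL φ k l → l ∈ Lits φ × toℕ k < toℕ (part (atomOf l))
    ℒ⇒later-part {l = l} (base l∈ vy vl) with allowed (atomOf l) _ (∈-map⁺ atomOf l∈) vl
    ... | j , inj₁ (lt , vy′) with y-block-unique vy vy′
    ...   | refl = l∈ , lt
    ℒ⇒later-part (base l∈ vy vl) | j , inj₂ (_ , vx) = ⊥-elim (x∉y-block vx vy)
    ℒ⇒later-part {k} (closure il vl vx r l′∈ wl′) with ℒ⇒later-part il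
    ... | l∈ , lt = l′∈ , subst (toℕ k <_) (reach⇒same-part (∈-map⁺ atomOf l∈) vl vx r (∈-map⁺ atomOf l′∈) wl′) lt

    GBSR⇒NoEarlierX : NoEarlierX φ
    GBSR⇒NoEarlierX k ℓ ℓ≤k v l il vl vxℓ with ℒ⇒later-part il
    ... | l∈ , lt with allowed (atomOf l) v (∈-map⁺ atomOf l∈) vl
    ...   | j , inj₁ (_ , vy) = x∉y-block vxℓ vy
    ...   | j , inj₂ (part≤j , vxj) with x-block-unique vxℓ vxj
    ...     | refl = <-irrefl refl (<-≤-trans lt (≤-trans part≤j ℓ≤k))

  InX? : Decidable (InX φ)
  InX? v = anyFin? (λ i → v ∈? xb i)

  ShareX : Atom → Atom → Set
  ShareX a b = Any (λ v → v ∈ varsA b × InX φ v) (varsA a)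

  shareX? : ∀ a → Decidable (ShareX a)
  shareX? a b = anyList? (λ v → (v ∈? varsA b) ×-dec InX? v) (varsA a)

  MeetsBlock : Atom → Fin n → Set
  MeetsBlock a j = ∃₂ λ v u → v ∈ varsA a × InX φ v × Reach φ v u × u ∈ xb j

  shareX-meetsBlock : ∀ a {b j} → b ∈ At φ → ShareX a b → MeetsBlock b j → MeetsBlock a j
  shareX-meetsBlock a b∈ sh (v , u , vb , vx , r , uxj) with find sh
  ... | w , wa , (wb , wx) = w , u , wa , wx , (wx , vx , _ , b∈ , wb , vb) ◅ r , uxj

  Witnessed : Atom → ℕ → Set
  Witnessed a k = k ≡ n ⊎ ∃[ j ] (MeetsBlock a j × k ≡ toℕ j)

  record Labelling (label : Atom → ℕ) : Set where
    field
      ≤-x-blocks : ∀ a {v i} → v ∈ varsA a → v ∈ xb i → label a ≤ toℕ i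
      witnessed  : ∀ a → Witnessed a (label a)

  initial-label : Atom → ℕ
  initial-label a = minOver (λ i → anyList? (_∈? xb i) (varsA a)) toℕ n (allFin n)

  initial-labelling : Labelling initial-label
  initial-labelling = record { ≤-x-blocks = ≤-x-blocks ; witnessed = witnessed }
    where
    ≤-x-blocks : ∀ a {v i} → v ∈ varsA a → v ∈ xb i → initial-label a ≤ toℕ i
    ≤-x-blocks a {i = i} va vx = minOver≤ (λ i → anyList? (_∈? xb i) (varsA a)) toℕ n (∈-allFin i) (lose va vx)

    witnessed : ∀ a → Witnessed a (initial-label a)
    witnessed a with minOver-sel (λ i → anyList? (_∈? xb i) (varsA a)) toℕ n (allFin n)
    ... | inj₁ e = inj₁ e
    ... | inj₂ (i , _ , v∈a∩xi , e) with find v∈a∩xi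
    ...   | v , va , vx = inj₂ (i , (v , v , va , (i , vx) , ε , vx) , e)

  relabel : (Atom → ℕ) → Atom → ℕ
  relabel label a = minOver (shareX? a) label (label a) (At φ)

  relabel≤ : ∀ label a → relabel label a ≤ label a
  relabel≤ label a = minOver≤default (shareX? a) label (label a) (At φ)

  relabel-labelling : ∀ {label} → Labelling label → Labelling (relabel label)
  relabel-labelling {label} L = record
    { ≤-x-blocks = λ a va vx → ≤-trans (relabel≤ label a) (≤-x-blocks a va vx)
    ; witnessed  = witnessed′ }
    where
    open Labelling L

    witnessed′ : ∀ a → Witnessed a (relabel label a)
    witnessed′ a with minOver-sel (shareX? a) label (label a) (At φ)
    ... | inj₁ e = subst (Witnessed a) (sym e) (witnessed a)
    ... | inj₂ (b , b∈ , sh , e) with witnessed b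
    ...   | inj₁ e′          = inj₁ (trans e e′)
    ...   | inj₂ (j , m , e′) = inj₂ (j , shareX-meetsBlock a b∈ sh m , trans e e′)

  Stable : (Atom → ℕ) → Set
  Stable label = All (λ a → relabel label a ≡ label a) (At φ)

  stable-labelling : ∃[ label ] (Labelling label × Stable label)
  stable-labelling =
    iterate-to-stable stable? relabel weight decreases relabel-labelling initial-labelling
    where
    stable? : Decidable Stable
    stable? label = allList? (λ a → relabel label a ≟ label a) (At φ)

    weight : (Atom → ℕ) → ℕ
    weight label = sum (map label (At φ))

    decreases : ∀ {label} → ¬ Stable label → weight (relabel label) < weight label
    decreases {label} ¬s =
      sum-map-mono-< (relabel≤ label) (¬All⇒Any¬ (λ a → relabel label a ≟ label a) (At φ) ¬s)

  module _ (H : NoEarlierX φ) where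

    meetsBlock⇒later : ∀ {l v i j} → l ∈ Lits φ → v ∈ yb i → v ∈ varsL l →
                       MeetsBlock (atomOf l) j → toℕ i < toℕ j
    meetsBlock⇒later {i = i} {j} l∈ vy vl (w , u , wa , wx , r , uxj) with allOccur u (x-block⊆prefix uxj)
    ... | l′ , l′∈ , ul′ = ≰⇒> λ j≤i → H i j j≤i u l′ (closure (base l∈ vy vl) wa wx r l′∈ ul′) ul′ uxj

    private
      label = proj₁ stable-labelling
      stable = proj₂ (proj₂ stable-labelling)
      open Labelling (proj₁ (proj₂ stable-labelling))

    label≤n : ∀ a → label a ≤ n
    label≤n a with witnessed a
    ... | inj₁ e           = subst (_≤ n) (sym e) ≤-refl
    ... | inj₂ (j , _ , e) = subst (_≤ n) (sym e) (<⇒≤ (toℕ<n j))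

    part : Atom → Fin (suc n)
    part a = fromℕ< (s≤s (label≤n a))

    toℕ-part : ∀ a → toℕ (part a) ≡ label a
    toℕ-part a = toℕ-fromℕ< (s≤s (label≤n a))

    y-block<label : ∀ {l v i} → l ∈ Lits φ → v ∈ yb i → v ∈ varsL l → toℕ i < label (atomOf l)
    y-block<label {l} {i = i} l∈ vy vl with witnessed (atomOf l)
    ... | inj₁ e           = subst (toℕ i <_) (sym e) (toℕ<n i)
    ... | inj₂ (j , m , e) = subst (toℕ i <_) (sym e) (meetsBlock⇒later l∈ vy vl m)

    part-allowed : ∀ a v → a ∈ At φ → v ∈ varsA a → AllowedIn φ (part a) v
    part-allowed a v a∈ va with ∈-map⁻ atomOf a∈
    ... | l , l∈ , refl with prefix-block (closed v l l∈ va)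
    ...   | i , inj₁ vx = i , inj₂ (subst (_≤ toℕ i) (sym (toℕ-part a)) (≤-x-blocks a va vx) , vx)
    ...   | i , inj₂ vy = i , inj₁ (subst (toℕ i <_) (sym (toℕ-part a)) (y-block<label l∈ vy va) , vy)

    part-separated : ∀ a b v → a ∈ At φ → b ∈ At φ → toℕ (part a) < toℕ (part b) →
                     v ∈ varsA a → v ∈ varsA b → InX φ v → ⊥
    part-separated a b v a∈ b∈ lt va vb vx = <⇒≱ label-a<label-b label-b≤label-a
      where
      label-a<label-b : label a < label b
      label-a<label-b = subst₂ _<_ (toℕ-part a) (toℕ-part b) lt

      label-b≤label-a : label b ≤ label a
      label-b≤label-a = subst (_≤ label a) (All-lookup stable b∈)
        (minOver≤ (shareX? b) label (label b) a∈ (lose vb (va , vx)))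

    NoEarlierX⇒GBSR : GBSR φ
    NoEarlierX⇒GBSR = part , part-allowed , part-separated

lemma4 : (φ : Sentence) → StandardForm φ →
    (GBSR φ ⇔
      (∀ (k ℓ : Fin (Sentence.n φ)) → toℕ ℓ ≤ toℕ k →
        ∀ v l → InL φ k l → v ∈ varsL l → v ∈ Sentence.xb φ ℓ → ⊥))
lemma4 φ sf = mk⇔ (GBSR⇒NoEarlierX φ sf) (NoEarlierX⇒GBSR φ sf)
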